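{- Let $\Pi_q$ be a projective plane of order $q$ and let $t\leq q-2$ be a positive integer. Let $\mathcal{S}_t$ be a $t$-semiarc in $\Pi_q$ of size $2(q-t)$ which has a $(q-t)$-secant $\ell$. Then $\mathcal{S}_t$ consists of the symmetric difference of two lines with $t$ further points removed from each line; that is, there is a line $\ell'\neq \ell$ such that $\mathcal{S}_t\subseteq (\ell\cup\ell')\setminus\{\ell\cap\ell'\}$ and $|\mathcal{S}_t\cap \ell|=|\mathcal{S}_t\cap\ell'|=q-t$.
   Context: A non-empty point set $\mathcal{S}_t$ of a projective plane $\Pi_q$ is a $t$-semiarc if for every point $P\in\mathcal{S}_t$ there are exactly $t$ lines $m$ with $m\cap \mathcal{S}_t=\{P\}$ (the tangents to $\mathcal{S}_t$ at $P$). A line meeting $\mathcal{S}_t$ in exactly $k$ points is a $k$-secant of $\mathcal{S}_t$. -}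

module Defs where

open import Data.Nat using (ℕ; zero; suc; _+_; _≤_; _∸_)
open import Data.Fin using (Fin; zero; suc)
open import Data.Bool using (Bool; true; false; _∧_; not; if_then_else_)
open import Data.Product using (Σ; _×_; _,_; ∃)
open import Relation.Binary.PropositionalEquality using (_≡_; _≢_)
open import Relation.Nullary.Decidable using (⌊_⌋)
import Data.Fin as F

count : ∀ {n} → (Fin n → Bool) → ℕ
count {zero}  p = 0
count {suc n} p = (if p zero then 1 else 0) + count (λ i → p (suc i))

allFin : ∀ {n} → (Fin n → Bool) → Bool
allFin {zero}  p = true
allFin {suc n} p = p zero ∧ allFin (λ i → p (suc i))

record ProjectivePlane (q : ℕ) : Set where
  field
    nPoints  : ℕ
    nLines   : ℕ
    inc      : Fin nPoints → Fin nLines → Bool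
    join     : ∀ P Q → P ≢ Q →
               Σ (Fin nLines) λ m → (inc P m ≡ true × inc Q m ≡ true) ×
                 (∀ m' → inc P m' ≡ true → inc Q m' ≡ true → m' ≡ m)
    meet     : ∀ l m → l ≢ m →
               Σ (Fin nPoints) λ P → (inc P l ≡ true × inc P m ≡ true) ×
                 (∀ P' → inc P' l ≡ true → inc P' m ≡ true → P' ≡ P)
    lineSize : ∀ l → count (λ P → inc P l) ≡ suc q
    pointDeg : ∀ P → count (λ l → inc P l) ≡ suc q
    order≥2  : 2 ≤ q

module _ {q : ℕ} (Π : ProjectivePlane q) where
  open ProjectivePlane Π

  Point : Set
  Point = Fin nPoints

  Line : Set
  Line = Fin nLines

  PointSet : Set
  PointSet = Point → Bool

  isTangentAt : PointSet → Point → Line → Bool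
  isTangentAt S P m =
    S P ∧ inc P m ∧ allFin (λ Q → not (S Q ∧ inc Q m) Data.Bool.∨ ⌊ Q F.≟ P ⌋)

  nTangents : PointSet → Point → ℕ
  nTangents S P = count (λ m → isTangentAt S P m)

  size : PointSet → ℕ
  size S = count S

  secantSize : PointSet → Line → ℕ
  secantSize S m = count (λ P → S P ∧ inc P m)

  IsSemiarc : ℕ → PointSet → Set
  IsSemiarc t S = (∃ λ P → S P ≡ true) × (∀ P → S P ≡ true → nTangents S P ≡ t)

module Submission where

-- Write k = q − t ≥ 2, A = S ∩ ℓ and B = S ∖ ℓ, so |A| = |B| = k.  At a point
-- X of S exactly (q + 1) − t = k + 1 lines through X are not tangents.
--   (1) For P ∈ A, the k non-tangent lines through P other than ℓ each carry
--       a point of B, distinct lines giving distinct points.  As |B| = k,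
--       no line through P can carry two points of B.
--   (2) For Q ∈ B, the k lines joining Q to the points of A are distinct,
--       non-tangent and, by (1), contain no further point of B.  Only one
--       non-tangent line through Q remains, so all of B lies on one line.
--   (3) The line ℓ' through two points of B therefore contains B, misses A
--       by (1), and meets S in |B| = k points.

open import Defs
open import Data.Nat using (ℕ; zero; suc; _+_; _*_; _∸_; _≤_; z≤n; s≤s)
open import Data.Nat.Properties
open import Data.Fin as F using (Fin)
import Data.Fin.Properties as FP
open import Data.Bool using (Bool; true; false; _∧_; _∨_; not)
import Data.Bool.Properties as BP
open import Data.Product using (Σ; _×_; _,_; proj₁; proj₂)
open import Data.Sum using (_⊎_; inj₁; inj₂)
open import Data.Empty using (⊥; ⊥-elim)
open import Relation.Binary.PropositionalEquality
  using (_≡_; _≢_; refl; sym; trans; cong; subst; module ≡-Reasoning)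
open import Relation.Nullary using (¬_; yes; no)
open import Relation.Nullary.Decidable using (⌊_⌋)
open import Axiom.UniquenessOfIdentityProofs using (module Decidable⇒UIP)

∧-true : ∀ {a b} → a ∧ b ≡ true → a ≡ true × b ≡ true
∧-true {a} {b} h = BP.∧-conicalˡ a b h , BP.∧-conicalʳ a b h

∧-intro : ∀ {a b} → a ≡ true → b ≡ true → a ∧ b ≡ true
∧-intro refl refl = refl

not-true : ∀ {b} → not b ≡ true → b ≡ false
not-true {false} _ = refl

not-false : ∀ {b} → b ≡ false → not b ≡ true
not-false refl = refl

third-false : ∀ a b {c} → a ≡ true → b ≡ true → a ∧ (b ∧ c) ≡ false → c ≡ false
third-false true true refl refl h = h

implication-false : ∀ a {d} → not a ∨ d ≡ false → a ≡ true × d ≡ false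
implication-false true {false} _ = refl , refl

implication-true : ∀ a {d} → a ≡ true → not a ∨ d ≡ true → d ≡ true
implication-true true refl h = h

false-if : ∀ {b} → ¬ (b ≡ true) → b ≡ false
false-if = BP.¬-not

true≢false : true ≢ false
true≢false ()

-- Equalities between Booleans are unique; needed to identify choices made
-- from two proofs of the same membership.
bool-uip : ∀ {a b : Bool} (x y : a ≡ b) → x ≡ y
bool-uip = Decidable⇒UIP.≡-irrelevant BP._≟_

≟-sound : ∀ {n} {x y : Fin n} → ⌊ x F.≟ y ⌋ ≡ true → x ≡ y
≟-sound {x = x} {y} h with x F.≟ y
... | yes x≡y = x≡y

≟-complete : ∀ {n} {x y : Fin n} → x ≡ y → ⌊ x F.≟ y ⌋ ≡ true
≟-complete {x = x} {y} x≡y with x F.≟ y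
... | yes _ = refl
... | no x≢y = ⊥-elim (x≢y x≡y)

≟-distinct : ∀ {n} {x y : Fin n} → x ≢ y → ⌊ x F.≟ y ⌋ ≡ false
≟-distinct {x = x} {y} x≢y with x F.≟ y
... | yes x≡y = ⊥-elim (x≢y x≡y)
... | no _ = refl

count-ext : ∀ {n} {p r : Fin n → Bool} → (∀ i → p i ≡ r i) → count p ≡ count r
count-ext {zero} h = refl
count-ext {suc n} {p} {r} h rewrite h F.zero = cong (_ +_) (count-ext (λ i → h (F.suc i)))

count-split : ∀ {n} (p c : Fin n → Bool) →
  count p ≡ count (λ i → p i ∧ c i) + count (λ i → p i ∧ not (c i))
count-split {zero} p c = refl
count-split {suc n} p c with p F.zero | c F.zero
... | true  | true  = cong suc (count-split (λ i → p (F.suc i)) (λ i → c (F.suc i)))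
... | true  | false = trans (cong suc (count-split (λ i → p (F.suc i)) (λ i → c (F.suc i))))
                          (sym (+-suc _ _))
... | false | _     = count-split (λ i → p (F.suc i)) (λ i → c (F.suc i))

count-none : ∀ {n} (p : Fin n → Bool) → (∀ i → p i ≡ false) → count p ≡ 0
count-none {zero} p h = refl
count-none {suc n} p h rewrite h F.zero = count-none _ (λ i → h (F.suc i))

count-pos : ∀ {n} (p : Fin n → Bool) j → p j ≡ true → 1 ≤ count p
count-pos p F.zero e rewrite e = s≤s z≤n
count-pos p (F.suc j) e = ≤-trans (count-pos (λ i → p (F.suc i)) j e) (m≤n+m _ _)

count-at-most-one : ∀ {n} (p : Fin n → Bool) →
  (∀ i j → p i ≡ true → p j ≡ true → i ≡ j) → count p ≤ 1
count-at-most-one {zero} p h = z≤n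
count-at-most-one {suc n} p h with p F.zero in e
... | true  = s≤s (≤-reflexive (count-none _ (λ i → false-if (λ pi → FP.0≢1+n (h F.zero (F.suc i) e pi)))))
... | false = count-at-most-one _ (λ i j pi pj → FP.suc-injective (h (F.suc i) (F.suc j) pi pj))

witness : ∀ {n} (p : Fin n → Bool) → 1 ≤ count p → Σ (Fin n) λ i → p i ≡ true
witness {suc n} p h with p F.zero in e
... | true = F.zero , e
... | false with witness (λ i → p (F.suc i)) h
...   | i , pi = F.suc i , pi

_without_ : ∀ {n} → (Fin n → Bool) → Fin n → (Fin n → Bool)
(r without j₀) j = r j ∧ not ⌊ j F.≟ j₀ ⌋

without-intro : ∀ {n} {r : Fin n → Bool} {j₀ j} → r j ≡ true → j ≢ j₀ → (r without j₀) j ≡ true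
without-intro rj j≢j₀ = ∧-intro rj (not-false (≟-distinct j≢j₀))

without-elim : ∀ {n} {r : Fin n → Bool} {j₀ j} → (r without j₀) j ≡ true → r j ≡ true × j ≢ j₀
without-elim {r = r} {j₀} {j} h =
  proj₁ (∧-true {r j} h) ,
  λ j≡j₀ → true≢false (trans (sym (≟-complete j≡j₀)) (not-true (proj₂ (∧-true {r j} h))))

count-without : ∀ {n} (r : Fin n → Bool) j₀ → count r ≤ suc (count (r without j₀))
count-without r j₀ = ≤-trans (≤-reflexive (count-split r (λ j → ⌊ j F.≟ j₀ ⌋)))
  (+-monoˡ-≤ _ (count-at-most-one _ (λ i j ri rj →
    trans (≟-sound (proj₂ (∧-true {r i} ri))) (sym (≟-sound (proj₂ (∧-true {r j} rj)))))))

count-without-member : ∀ {n} (r : Fin n → Bool) j₀ → r j₀ ≡ true → suc (count (r without j₀)) ≤ count r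
count-without-member r j₀ e =
  ≤-trans (+-monoˡ-≤ _ (count-pos (λ j → r j ∧ ⌊ j F.≟ j₀ ⌋) j₀ (∧-intro e (≟-complete refl))))
          (≤-reflexive (sym (count-split r (λ j → ⌊ j F.≟ j₀ ⌋))))

inject : ∀ {n m} (p : Fin n → Bool) (r : Fin m → Bool)
  (f : ∀ i → p i ≡ true → Fin m) →
  (∀ i pi → r (f i pi) ≡ true) →
  (∀ i j pi pj → f i pi ≡ f j pj → i ≡ j) →
  count p ≤ count r
inject {zero} p r f lands injective = z≤n
inject {suc n} p r f lands injective with p F.zero in e
... | false = inject (λ i → p (F.suc i)) r (λ i pi → f (F.suc i) pi) (λ i pi → lands (F.suc i) pi)
                (λ i j pi pj eq → FP.suc-injective (injective _ _ pi pj eq))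
... | true = ≤-trans (s≤s rest) (count-without-member r (f F.zero e) (lands F.zero e))
  where
  rest : count (λ i → p (F.suc i)) ≤ count (r without f F.zero e)
  rest = inject (λ i → p (F.suc i)) (r without f F.zero e) (λ i pi → f (F.suc i) pi)
           (λ i pi → without-intro {r = r} (lands (F.suc i) pi)
              (λ eq → FP.0≢1+n (sym (injective (F.suc i) F.zero pi e eq))))
           (λ i j pi pj eq → FP.suc-injective (injective _ _ pi pj eq))

inject-strict : ∀ {n m} (p : Fin n → Bool) (r : Fin m → Bool)
  (f : ∀ i → p i ≡ true → Fin m) →
  (∀ i pi → r (f i pi) ≡ true) →
  (∀ i j pi pj → f i pi ≡ f j pj → i ≡ j) →
  ∀ j₀ → r j₀ ≡ true → (∀ i pi → f i pi ≢ j₀) →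
  suc (count p) ≤ count r
inject-strict p r f lands injective j₀ e misses =
  ≤-trans (s≤s (inject p (r without j₀) f (λ i pi → without-intro {r = r} (lands i pi) (misses i pi)) injective))
          (count-without-member r j₀ e)

allFin-elim : ∀ {n} {p : Fin n → Bool} → allFin p ≡ true → ∀ i → p i ≡ true
allFin-elim {p = p} h F.zero = proj₁ (∧-true {p F.zero} h)
allFin-elim {p = p} h (F.suc i) = allFin-elim (proj₂ (∧-true {p F.zero} h)) i

allFin-false : ∀ {n} {p : Fin n → Bool} → allFin p ≡ false → Σ (Fin n) λ i → p i ≡ false
allFin-false {suc n} {p} h with p F.zero in e
... | false = F.zero , e
... | true with allFin-false {p = λ i → p (F.suc i)} h
...   | i , pi = F.suc i , pi

module Incidence {q : ℕ} (Π : ProjectivePlane q) (S : PointSet Π) where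
  open ProjectivePlane Π

  line-unique : ∀ {P Q m m'} → P ≢ Q → inc P m ≡ true → inc Q m ≡ true →
    inc P m' ≡ true → inc Q m' ≡ true → m ≡ m'
  line-unique {P} {Q} {m} {m'} P≢Q Pm Qm Pm' Qm' =
    trans (proj₂ (proj₂ (join P Q P≢Q)) m Pm Qm) (sym (proj₂ (proj₂ (join P Q P≢Q)) m' Pm' Qm'))

  joinLine : ∀ P Q → P ≢ Q → Line Π
  joinLine P Q P≢Q = proj₁ (join P Q P≢Q)

  join-inc₁ : ∀ {P Q} (P≢Q : P ≢ Q) → inc P (joinLine P Q P≢Q) ≡ true
  join-inc₁ {P} {Q} P≢Q = proj₁ (proj₁ (proj₂ (join P Q P≢Q)))

  join-inc₂ : ∀ {P Q} (P≢Q : P ≢ Q) → inc Q (joinLine P Q P≢Q) ≡ true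
  join-inc₂ {P} {Q} P≢Q = proj₂ (proj₁ (proj₂ (join P Q P≢Q)))

  tangent-inc : ∀ {P m} → isTangentAt Π S P m ≡ true → inc P m ≡ true
  tangent-inc {P} {m} h = proj₁ (∧-true {inc P m} (proj₂ (∧-true {S P} h)))

  tangent-excludes : ∀ {P m Q} → isTangentAt Π S P m ≡ true → S Q ≡ true → inc Q m ≡ true → Q ≢ P → ⊥
  tangent-excludes {P} {m} {Q} h SQ Qm Q≢P =
    Q≢P (≟-sound (implication-true (S Q ∧ inc Q m) (∧-intro SQ Qm)
                   (allFin-elim (proj₂ (∧-true {inc P m} (proj₂ (∧-true {S P} h)))) Q)))

  secant-not-tangent : ∀ {P m Q} → S Q ≡ true → inc Q m ≡ true → Q ≢ P → isTangentAt Π S P m ≡ false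
  secant-not-tangent SQ Qm Q≢P = false-if (λ h → tangent-excludes h SQ Qm Q≢P)

  second-point : ∀ {P m} → S P ≡ true → inc P m ≡ true → isTangentAt Π S P m ≡ false →
    Σ (Point Π) λ Q → S Q ≡ true × inc Q m ≡ true × Q ≢ P
  second-point {P} {m} SP Pm h
    with Q , e ← allFin-false (third-false (S P) (inc P m) SP Pm h)
    with on-m , Q≢P ← implication-false (S Q ∧ inc Q m) e
    = Q , proj₁ (∧-true {S Q} on-m) , proj₂ (∧-true {S Q} on-m) ,
      λ Q≡P → true≢false (trans (sym (≟-complete Q≡P)) Q≢P)

  nonTangent : Point Π → Line Π → Bool
  nonTangent P m = inc P m ∧ not (isTangentAt Π S P m)

  nonTangent-intro : ∀ {P m} → inc P m ≡ true → isTangentAt Π S P m ≡ false → nonTangent P m ≡ true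
  nonTangent-intro Pm h = ∧-intro Pm (not-false h)

  nonTangent-elim : ∀ {P m} → nonTangent P m ≡ true → inc P m ≡ true × isTangentAt Π S P m ≡ false
  nonTangent-elim {P} {m} h = proj₁ (∧-true {inc P m} h) , not-true (proj₂ (∧-true {inc P m} h))

  nonTangent-count : ∀ {t P} → nTangents Π S P ≡ t → t + count (nonTangent P) ≡ suc q
  nonTangent-count {t} {P} tangents = begin
    t + count (nonTangent P)
      ≡⟨ cong (_+ count (nonTangent P)) (sym tangents) ⟩
    nTangents Π S P + count (nonTangent P)
      ≡⟨ cong (_+ count (nonTangent P)) (count-ext tangents-through-P) ⟨
    count (λ m → inc P m ∧ isTangentAt Π S P m) + count (nonTangent P)
      ≡⟨ count-split (inc P) (isTangentAt Π S P) ⟨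
    count (inc P)
      ≡⟨ pointDeg P ⟩
    suc q ∎
    where
    open ≡-Reasoning
    tangents-through-P : ∀ m → inc P m ∧ isTangentAt Π S P m ≡ isTangentAt Π S P m
    tangents-through-P m with isTangentAt Π S P m in e
    ... | true  = cong (_∧ true) (tangent-inc e)
    ... | false = BP.∧-zeroʳ (inc P m)

module Configuration (q : ℕ) (Π : ProjectivePlane q) (t : ℕ) (t+2≤q : t + 2 ≤ q)
  (S : PointSet Π) (semiarc : IsSemiarc Π t S) (size-S : size Π S ≡ 2 * (q ∸ t))
  (ℓ : Line Π) (secant-ℓ : secantSize Π S ℓ ≡ q ∸ t) where
  open ProjectivePlane Π
  open Incidence Π S

  k : ℕ
  k = q ∸ t

  t+k≡q : t + k ≡ q
  t+k≡q = m+[n∸m]≡n (≤-trans (m≤m+n t 2) t+2≤q)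

  2≤k : 2 ≤ k
  2≤k = +-cancelˡ-≤ t 2 k (subst (t + 2 ≤_) (sym t+k≡q) t+2≤q)

  OnA : Point Π → Set
  OnA P = S P ≡ true × inc P ℓ ≡ true

  OnB : Point Π → Set
  OnB Q = S Q ≡ true × inc Q ℓ ≡ false

  inB : Point Π → Bool
  inB Q = S Q ∧ not (inc Q ℓ)

  inB-elim : ∀ {Q} → inB Q ≡ true → OnB Q
  inB-elim {Q} h = proj₁ (∧-true {S Q} h) , not-true (proj₂ (∧-true {S Q} h))

  inB-intro : ∀ {Q} → OnB Q → inB Q ≡ true
  inB-intro (SQ , Qℓ) = ∧-intro SQ (not-false Qℓ)

  A≢B : ∀ {P Q} → OnA P → OnB Q → Q ≢ P
  A≢B (_ , Pℓ) (_ , Qℓ) refl = true≢false (trans (sym Pℓ) Qℓ)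

  |B|≡k : count inB ≡ k
  |B|≡k = +-cancelˡ-≡ k (count inB) k (begin
    k + count inB                  ≡⟨ cong (_+ count inB) secant-ℓ ⟨
    secantSize Π S ℓ + count inB   ≡⟨ count-split S (λ P → inc P ℓ) ⟨
    size Π S                       ≡⟨ size-S ⟩
    k + (k + 0)                    ≡⟨ cong (k +_) (+-identityʳ k) ⟩
    k + k                          ∎)
    where open ≡-Reasoning

  |nonTangent|≡1+k : ∀ {X} → S X ≡ true → count (nonTangent X) ≡ suc k
  |nonTangent|≡1+k {X} SX = +-cancelˡ-≡ t _ _
    (trans (nonTangent-count (proj₂ semiarc X SX)) (trans (cong suc (sym t+k≡q)) (sym (+-suc t k))))

  -- The k non-tangents through P other than ℓ are sent injectively into B
  -- by choosing a second point of S on each; if m carried two points of B,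
  -- one of them would be missed, giving k < |B| = k.
  A-sees-B-once : ∀ {P Q₁ Q₂ m} → OnA P → OnB Q₁ → OnB Q₂ → Q₁ ≢ Q₂ →
    inc P m ≡ true → inc Q₁ m ≡ true → inc Q₂ m ≡ true → ⊥
  A-sees-B-once {P} {Q₁} {Q₂} {m} a@(SP , Pℓ) b₁@(_ , Q₁ℓ) b₂ Q₁≢Q₂ Pm Q₁m Q₂m =
    1+n≰n k+1≤k
    where
    other : Line Π → Bool
    other = nonTangent P without ℓ

    other-elim : ∀ {m'} → other m' ≡ true → nonTangent P m' ≡ true × m' ≢ ℓ
    other-elim = without-elim {r = nonTangent P}

    other-inc : ∀ {m'} → other m' ≡ true → inc P m' ≡ true
    other-inc h = proj₁ (nonTangent-elim (proj₁ (other-elim h)))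

    pick-data : ∀ m' → other m' ≡ true → Σ (Point Π) λ Q → S Q ≡ true × inc Q m' ≡ true × Q ≢ P
    pick-data m' h = second-point SP (other-inc h) (proj₂ (nonTangent-elim (proj₁ (other-elim h))))

    pick : ∀ m' → other m' ≡ true → Point Π
    pick m' h = proj₁ (pick-data m' h)

    pick-on : ∀ m' h → inc (pick m' h) m' ≡ true
    pick-on m' h = proj₁ (proj₂ (proj₂ (pick-data m' h)))

    pick≢P : ∀ m' h → pick m' h ≢ P
    pick≢P m' h = proj₂ (proj₂ (proj₂ (pick-data m' h)))

    -- the chosen point is off ℓ, since P is the only point of ℓ on m' ≠ ℓ
    pick-in-B : ∀ m' h → inB (pick m' h) ≡ true
    pick-in-B m' h = ∧-intro (proj₁ (proj₂ (pick-data m' h))) (not-false (false-if λ on-ℓ →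
      proj₂ (other-elim h) (line-unique (pick≢P m' h) (pick-on m' h) (other-inc h) on-ℓ Pℓ)))

    pick-injective : ∀ m₁ m₂ h₁ h₂ → pick m₁ h₁ ≡ pick m₂ h₂ → m₁ ≡ m₂
    pick-injective m₁ m₂ h₁ h₂ eq = line-unique (pick≢P m₁ h₁) (pick-on m₁ h₁) (other-inc h₁)
      (subst (λ X → inc X m₂ ≡ true) (sym eq) (pick-on m₂ h₂)) (other-inc h₂)

    m-other : other m ≡ true
    m-other = without-intro {r = nonTangent P}
      (nonTangent-intro Pm (secant-not-tangent (proj₁ b₁) Q₁m (A≢B a b₁)))
      (λ { refl → true≢false (trans (sym Q₁m) Q₁ℓ) })

    picked-on-m : ∀ {Q} m' h → OnB Q → inc Q m ≡ true → pick m' h ≡ Q → pick m' h ≡ pick m m-other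
    picked-on-m m' h bQ Qm refl with line-unique (A≢B a bQ) (pick-on m' h) (other-inc h) Qm Pm
    ... | refl = cong (pick m) (bool-uip h m-other)

    missed : Σ (Point Π) λ Q → OnB Q × inc Q m ≡ true × pick m m-other ≢ Q
    missed with pick m m-other F.≟ Q₁
    ... | yes picked-Q₁ = Q₂ , b₂ , Q₂m , λ picked-Q₂ → Q₁≢Q₂ (trans (sym picked-Q₁) picked-Q₂)
    ... | no not-Q₁ = Q₁ , b₁ , Q₁m , not-Q₁

    into-B : suc (count other) ≤ count inB
    into-B with Q , bQ , Qm , not-Q ← missed =
      inject-strict other inB pick pick-in-B pick-injective Q (inB-intro bQ)
        (λ m' h picked → not-Q (trans (sym (picked-on-m m' h bQ Qm picked)) picked))

    k+1≤k : suc k ≤ k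
    k+1≤k = begin
      suc k                 ≡⟨ |nonTangent|≡1+k SP ⟨
      count (nonTangent P)  ≤⟨ count-without (nonTangent P) ℓ ⟩
      suc (count other)     ≤⟨ into-B ⟩
      count inB             ≡⟨ |B|≡k ⟩
      k                     ∎
      where open ≤-Reasoning

  -- Otherwise the lines joining Q₁ to the k points of A would be
  -- k distinct non-tangents through Q₁ avoiding both of them (by step (1)),
  -- giving k + 2 non-tangents through Q₁ instead of k + 1.
  B-collinear : ∀ {Q₁ Q₂ Q₃ m₂ m₃} → OnB Q₁ → OnB Q₂ → OnB Q₃ → Q₂ ≢ Q₁ → Q₃ ≢ Q₁ →
    inc Q₁ m₂ ≡ true → inc Q₂ m₂ ≡ true → inc Q₁ m₃ ≡ true → inc Q₃ m₃ ≡ true → m₂ ≡ m₃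
  B-collinear {Q₁} {Q₂} {Q₃} {m₂} {m₃} b₁@(SQ₁ , Q₁ℓ) b₂ b₃ Q₂≢Q₁ Q₃≢Q₁ Q₁m₂ Q₂m₂ Q₁m₃ Q₃m₃
    with m₂ F.≟ m₃
  ... | yes m₂≡m₃ = m₂≡m₃
  ... | no m₂≢m₃ = ⊥-elim (1+n≰n k+2≤k+1)
    where
    inA : Point Π → Bool
    inA P = S P ∧ inc P ℓ

    inA-elim : ∀ {P} → inA P ≡ true → OnA P
    inA-elim {P} h = ∧-true {S P} h

    joinA : ∀ P → inA P ≡ true → Line Π
    joinA P h = joinLine Q₁ P (A≢B (inA-elim h) b₁)

    joinA-lands : ∀ P h → (nonTangent Q₁ without m₂) (joinA P h) ≡ true
    joinA-lands P h = without-intro {r = nonTangent Q₁}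
      (nonTangent-intro (join-inc₁ _)
        (secant-not-tangent (proj₁ (inA-elim h)) (join-inc₂ _) (λ e → A≢B (inA-elim h) b₁ (sym e))))
      (λ e → A-sees-B-once (inA-elim h) b₁ b₂ (λ e' → Q₂≢Q₁ (sym e'))
        (subst (λ m → inc P m ≡ true) e (join-inc₂ _)) Q₁m₂ Q₂m₂)

    joinA-misses-m₃ : ∀ P h → joinA P h ≢ m₃
    joinA-misses-m₃ P h e = A-sees-B-once (inA-elim h) b₁ b₃ (λ e' → Q₃≢Q₁ (sym e'))
      (subst (λ m → inc P m ≡ true) e (join-inc₂ _)) Q₁m₃ Q₃m₃

    -- distinct points of A span ℓ, which does not pass through Q₁
    joinA-injective : ∀ P₁ P₂ h₁ h₂ → joinA P₁ h₁ ≡ joinA P₂ h₂ → P₁ ≡ P₂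
    joinA-injective P₁ P₂ h₁ h₂ eq with P₁ F.≟ P₂
    ... | yes P₁≡P₂ = P₁≡P₂
    ... | no P₁≢P₂ = ⊥-elim (true≢false (trans (sym Q₁-on-ℓ) Q₁ℓ))
      where
      ℓ≡join : ℓ ≡ joinA P₁ h₁
      ℓ≡join = line-unique P₁≢P₂ (proj₂ (inA-elim h₁)) (proj₂ (inA-elim h₂))
        (join-inc₂ _) (subst (λ m → inc P₂ m ≡ true) (sym eq) (join-inc₂ _))
      Q₁-on-ℓ : inc Q₁ ℓ ≡ true
      Q₁-on-ℓ = subst (λ m → inc Q₁ m ≡ true) (sym ℓ≡join) (join-inc₁ _)

    m₂-nonTangent : nonTangent Q₁ m₂ ≡ true
    m₂-nonTangent = nonTangent-intro Q₁m₂ (secant-not-tangent (proj₁ b₂) Q₂m₂ Q₂≢Q₁)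

    m₃-remains : (nonTangent Q₁ without m₂) m₃ ≡ true
    m₃-remains = without-intro {r = nonTangent Q₁}
      (nonTangent-intro Q₁m₃ (secant-not-tangent (proj₁ b₃) Q₃m₃ Q₃≢Q₁)) (λ e → m₂≢m₃ (sym e))

    k+2≤k+1 : suc (suc k) ≤ suc k
    k+2≤k+1 = begin
      suc (suc k)                             ≡⟨ cong (λ n → suc (suc n)) secant-ℓ ⟨
      suc (suc (count inA))                   ≤⟨ s≤s (inject-strict inA (nonTangent Q₁ without m₂)
                                                   joinA joinA-lands joinA-injective
                                                   m₃ m₃-remains joinA-misses-m₃) ⟩
      suc (count (nonTangent Q₁ without m₂))  ≤⟨ count-without-member (nonTangent Q₁) m₂ m₂-nonTangent ⟩
      count (nonTangent Q₁)                   ≡⟨ |nonTangent|≡1+k SQ₁ ⟩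
      suc k                                   ∎
      where open ≤-Reasoning

  two-points-of-B : Σ (Point Π) λ Q₁ → Σ (Point Π) λ Q₂ → OnB Q₁ × OnB Q₂ × Q₁ ≢ Q₂
  two-points-of-B
    with Q₁ , Q₁∈B ← witness inB (≤-trans (s≤s z≤n) (≤-trans 2≤k (≤-reflexive (sym |B|≡k))))
    with Q₂ , Q₂∈B∖Q₁ ← witness (inB without Q₁) (≤-pred (≤-trans 2≤k
           (≤-trans (≤-reflexive (sym |B|≡k)) (count-without inB Q₁))))
    with Q₂∈B , Q₂≢Q₁ ← without-elim {r = inB} Q₂∈B∖Q₁
    = Q₁ , Q₂ , inB-elim Q₁∈B , inB-elim Q₂∈B , λ e → Q₂≢Q₁ (sym e)

  module SecondLine {Q₁ Q₂ : Point Π} (b₁ : OnB Q₁) (b₂ : OnB Q₂) (Q₁≢Q₂ : Q₁ ≢ Q₂) where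

    ℓ' : Line Π
    ℓ' = joinLine Q₁ Q₂ Q₁≢Q₂

    -- Q₁ lies on ℓ' but not on ℓ
    ℓ'≢ℓ : ℓ' ≢ ℓ
    ℓ'≢ℓ e = true≢false (trans (sym (subst (λ m → inc Q₁ m ≡ true) e (join-inc₁ Q₁≢Q₂))) (proj₂ b₁))

    B-on-ℓ' : ∀ {Q} → OnB Q → inc Q ℓ' ≡ true
    B-on-ℓ' {Q} bQ with Q F.≟ Q₁ | Q F.≟ Q₂
    ... | yes refl | _ = join-inc₁ Q₁≢Q₂
    ... | no _ | yes refl = join-inc₂ Q₁≢Q₂
    ... | no Q≢Q₁ | no _ = subst (λ m → inc Q m ≡ true) (sym ℓ'≡Q₁Q) (join-inc₂ Q₁≢Q)
      where
      Q₁≢Q : Q₁ ≢ Q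
      Q₁≢Q e = Q≢Q₁ (sym e)
      ℓ'≡Q₁Q : ℓ' ≡ joinLine Q₁ Q Q₁≢Q
      ℓ'≡Q₁Q = B-collinear b₁ b₂ bQ (λ e → Q₁≢Q₂ (sym e)) Q≢Q₁
        (join-inc₁ Q₁≢Q₂) (join-inc₂ Q₁≢Q₂) (join-inc₁ Q₁≢Q) (join-inc₂ Q₁≢Q)

    A-off-ℓ' : ∀ {P} → OnA P → inc P ℓ' ≡ true → ⊥
    A-off-ℓ' a Pℓ' = A-sees-B-once a b₁ b₂ Q₁≢Q₂ Pℓ' (join-inc₁ Q₁≢Q₂) (join-inc₂ Q₁≢Q₂)

    covered : ∀ {P} → S P ≡ true → inc P ℓ ≡ true ⊎ inc P ℓ' ≡ true
    covered {P} SP with inc P ℓ in Pℓ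
    ... | true  = inj₁ refl
    ... | false = inj₂ (B-on-ℓ' (SP , Pℓ))

    -- S ∩ ℓ' is exactly B
    secant-ℓ' : secantSize Π S ℓ' ≡ k
    secant-ℓ' = trans (count-ext on-ℓ'-iff-in-B) |B|≡k
      where
      on-ℓ'-iff-in-B : ∀ P → S P ∧ inc P ℓ' ≡ inB P
      on-ℓ'-iff-in-B P with S P in SP | inc P ℓ in Pℓ
      ... | false | _     = refl
      ... | true  | true  = false-if (A-off-ℓ' (SP , Pℓ))
      ... | true  | false = B-on-ℓ' (SP , Pℓ)

proposition2p3 : (q : ℕ) (Π : ProjectivePlane q) (t : ℕ) → 1 ≤ t → t + 2 ≤ q →
    (S : PointSet Π) → IsSemiarc Π t S → size Π S ≡ 2 * (q ∸ t) →
    (ℓ : Line Π) → secantSize Π S ℓ ≡ q ∸ t →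
    Σ (Line Π) λ ℓ' → ℓ' ≢ ℓ ×
      (∀ P → S P ≡ true →
        (ProjectivePlane.inc Π P ℓ ≡ true ⊎ ProjectivePlane.inc Π P ℓ' ≡ true) ×
        ¬ (ProjectivePlane.inc Π P ℓ ≡ true × ProjectivePlane.inc Π P ℓ' ≡ true)) ×
      secantSize Π S ℓ ≡ q ∸ t × secantSize Π S ℓ' ≡ q ∸ t
proposition2p3 q Π t _ t+2≤q S semiarc size-S ℓ secant-ℓ =
  let open Configuration q Π t t+2≤q S semiarc size-S ℓ secant-ℓ
      (Q₁ , Q₂ , b₁ , b₂ , Q₁≢Q₂) = two-points-of-B
      open SecondLine b₁ b₂ Q₁≢Q₂
  in ℓ' , ℓ'≢ℓ ,
     (λ P SP → covered SP , λ (Pℓ , Pℓ') → A-off-ℓ' (SP , Pℓ) Pℓ') ,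
     secant-ℓ , secant-ℓ'
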